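{- In the setting below, let $T_{\min}$ be an addition tree over $X$ of minimum cost and let $z$ be a node of $T_{\min}$ (identified with its value). (1) If $z<0$ then $|z|\le H$. (2) If $z>0$ then $z<H$.
   Context: Let $m,K$ be positive integers and $b_1,\ldots,b_{3m}$ positive integers with $K/4<b_i<K/2$ and $\sum_i b_i=mK$. Set $W=100(5m)^2K$, $a_i=b_i+W$, $L=3W+K$, $\varepsilon=1/(400(5m)^2)$, $h=\lfloor4\varepsilon L\rfloor$, $H=L+h$. Let $X$ be the multiset consisting of $a_1,\ldots,a_{3m}$, $m$ copies of $-H$ and $m$ copies of $h$. An addition tree over $X$ is a rooted full binary tree whose leaves are in bijection with the elements of $X$ (with multiplicity), labelled by them; a node's value is the sum of the labels of leaves in its subtree. The cost is the sum of absolute values of internal nodes. -}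

module Defs where

open import Data.Nat as ℕ using (ℕ; zero; suc; _*_; _/_)
open import Data.Integer as ℤ using (ℤ; +_; -_; ∣_∣)
open import Data.List using (List; []; _∷_; _++_; replicate; map)
open import Data.List.Relation.Binary.Permutation.Propositional using (_↭_)
open import Data.Vec as Vec using (Vec; toList)

Wof : ℕ → ℕ → ℕ
Wof m K = 100 * ((5 * m) * (5 * m)) * K

Lof : ℕ → ℕ → ℕ
Lof m K = 3 * Wof m K ℕ.+ K

-- h = ⌊ 4 ε L ⌋ with ε = 1/(400 (5m)^2), i.e. h = ⌊ L / (2500 m²) ⌋.
-- (m = 0 never occurs under the hypotheses; the value 0 there is a dummy.)
hof : ℕ → ℕ → ℕ
hof zero    K = 0
hof (suc n) K = Lof (suc n) K / (2500 * suc n * suc n)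

Hof : ℕ → ℕ → ℕ
Hof m K = Lof m K ℕ.+ hof m K

Xof : (m K : ℕ) → Vec ℕ (3 * m) → List ℤ
Xof m K b =
  map (λ bi → + (bi ℕ.+ Wof m K)) (toList b)
  ++ replicate m (- (+ Hof m K))
  ++ replicate m (+ hof m K)

data Tree : Set where
  leaf : ℤ → Tree
  node : Tree → Tree → Tree

leaves : Tree → List ℤ
leaves (leaf x)   = x ∷ []
leaves (node l r) = leaves l ++ leaves r

val : Tree → ℤ
val (leaf x)   = x
val (node l r) = val l ℤ.+ val r

cost : Tree → ℕ
cost (leaf x)       = 0
cost t@(node l r) = ∣ val t ∣ ℕ.+ cost l ℕ.+ cost r

-- An addition tree over the multiset X: its leaves are in bijection
-- with the elements of X (with multiplicity), i.e. leaf labels are a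
-- permutation of X.
AdditionTreeOver : List ℤ → Tree → Set
AdditionTreeOver X t = leaves t ↭ X

data _⊑_ : Tree → Tree → Set where
  here  : ∀ {t} → t ⊑ t
  left  : ∀ {s l r} → s ⊑ l → s ⊑ node l r
  right : ∀ {s l r} → s ⊑ r → s ⊑ node l r

-- Every subtree of a cost-minimal tree is cost-minimal among trees with the same leaves and value,
-- so regrouping a node z = x + y with its sibling s gives |x + y| ≤ |x + s| and |x + y| ≤ |y + s|.
-- A sign analysis then yields one of x, y, x + y + s, s of absolute value larger than |z| ≠ 0, so
-- |·| is maximised over the nodes at a leaf or at the root. The elements of X lie in [-H, H) and
-- the root has value ΣX = 0, so every node lies in [-H, H]; a node of value exactly H is neither a
-- leaf nor the root, so it would have a neighbour of absolute value above H.
module Submission where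

open import Defs
open import Algebra.Bundles using (CommutativeMonoid)
import Algebra.Properties.CommutativeSemigroup as CommutativeSemigroupProperties
open import Data.Integer as ℤ
  using (ℤ; +_; -_; -[1+_]; +[1+_]; 0ℤ; _⊖_; ∣_∣; +≤+; +<+; -≤+; -<+)
import Data.Integer.Properties as ℤ
open import Data.List using (List; []; _∷_; _++_; foldr; map; replicate)
open import Data.List.Membership.Propositional using (_∈_)
open import Data.List.Membership.Propositional.Properties using (∈-++⁺ˡ; ∈-++⁺ʳ)
open import Data.List.Relation.Binary.Permutation.Propositional
  using (_↭_; ↭-trans; ↭⇒↭ₛ; module PermutationReasoning)
open import Data.List.Relation.Binary.Permutation.Propositional.Properties
  using (++⁺ˡ; ++⁺ʳ; ++-comm; ++-assoc; ∈-resp-↭)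
open import Data.List.Relation.Binary.Permutation.Setoid.Properties using (foldr-commMonoid)
open import Data.List.Relation.Unary.All as All using (All)
open import Data.List.Relation.Unary.All.Properties using (++⁺; map⁺; replicate⁺)
open import Data.List.Relation.Unary.Any using (here)
open import Data.Nat as ℕ using (ℕ; zero; suc; _+_; _*_; _≤_; _<_; z≤n; s≤s; z<s)
open import Data.Nat.Properties
open import Data.Nat.Tactic.RingSolver using (solve-∀)
open import Data.Product using (_×_; _,_; proj₁; proj₂; uncurry; ∃-syntax)
open import Data.Sum using (_⊎_; inj₁; inj₂)
open import Data.Vec as Vec using (Vec; lookup; toList)
open import Data.Vec.Relation.Unary.All.Properties using (lookup⁻; toList⁺)
open import Function using (_∘_)
open import Relation.Binary.Definitions using (tri<; tri≈; tri>)
open import Relation.Binary.PropositionalEquality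
  using (_≡_; _≢_; refl; sym; trans; cong; cong₂; subst; subst₂; module ≡-Reasoning)
open import Relation.Nullary using (¬_; yes; no; contradiction)

module ℕ-+ = CommutativeSemigroupProperties +-commutativeSemigroup
module ℤ-+ = CommutativeSemigroupProperties ℤ.+-commutativeSemigroup

module _ {A : Set} {P : A → Set} (f : A → ℕ) {N : ℕ}
         (bounded : ∀ {a} → P a → f a ≤ N)
         (ascend : ∀ {a} → P a → ∃[ b ] P b × f a < f b) where

  bounded-ascent-impossible : ∀ {a} → ¬ P a
  bounded-ascent-impossible {a} pa =
    <-irrefl refl (≤-trans (m≤m+n (suc N) (f a)) (headroom (suc N) pa))
    where
    headroom : ∀ k {a} → P a → k + f a ≤ N
    headroom zero    pa = bounded pa
    headroom (suc k) pa with ascend pa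
    ... | b , pb , fa<fb = ≤-trans (+-monoʳ-< k fa<fb) (headroom k pb)

∣-i+-j∣≡∣i+j∣ : ∀ i j → ∣ - i ℤ.+ - j ∣ ≡ ∣ i ℤ.+ j ∣
∣-i+-j∣≡∣i+j∣ i j = trans (cong ∣_∣ (sym (ℤ.neg-distrib-+ i j))) (ℤ.∣-i∣≡∣i∣ (i ℤ.+ j))

0≤i<j⇒∣i∣<∣j∣ : ∀ {i j} → 0ℤ ℤ.≤ i → i ℤ.< j → ∣ i ∣ < ∣ j ∣
0≤i<j⇒∣i∣<∣j∣ 0≤i i<j =
  ℤ.drop‿+<+ (subst₂ ℤ._<_ (sym (ℤ.0≤i⇒+∣i∣≡i 0≤i)) (sym (ℤ.0≤i⇒+∣i∣≡i 0≤j)) i<j)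
  where 0≤j = ℤ.<⇒≤ (ℤ.≤-<-trans 0≤i i<j)

∣i+j∣<∣j∣ : ∀ i j → i ℤ.< 0ℤ → 0ℤ ℤ.< i ℤ.+ j → ∣ i ℤ.+ j ∣ < ∣ j ∣
∣i+j∣<∣j∣ i j i<0 0<i+j = 0≤i<j⇒∣i∣<∣j∣ (ℤ.<⇒≤ 0<i+j)
  (subst (i ℤ.+ j ℤ.<_) (ℤ.+-identityˡ j) (ℤ.+-monoˡ-< j i<0))

∣i+j∣<∣i∣ : ∀ i j → j ℤ.< 0ℤ → 0ℤ ℤ.< i ℤ.+ j → ∣ i ℤ.+ j ∣ < ∣ i ∣
∣i+j∣<∣i∣ i j j<0 0<i+j = 0≤i<j⇒∣i∣<∣j∣ (ℤ.<⇒≤ 0<i+j)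
  (subst (i ℤ.+ j ℤ.<_) (ℤ.+-identityʳ i) (ℤ.+-monoʳ-< i j<0))

o≤∣m⊖1+n∣⇒o<1+n : ∀ {m n o} → 0 < m → m ≤ o → o ≤ ∣ m ⊖ suc n ∣ → o < suc n
o≤∣m⊖1+n∣⇒o<1+n {m} {n} 0<m m≤o o≤∣m⊖1+n∣ with m ℕ.<? suc n
... | yes m<1+n = ≤-<-trans (subst (_ ≤_) (ℤ.∣⊖∣-< m<1+n) o≤∣m⊖1+n∣) (∸-monoʳ-< 0<m (<⇒≤ m<1+n))
... | no m≮1+n  = contradiction (≤-trans m≤o (subst (_ ≤_) (cong ∣_∣ (ℤ.⊖-≥ 1+n≤m)) o≤∣m⊖1+n∣))
                                (<⇒≱ (∸-monoʳ-< z<s 1+n≤m))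
  where 1+n≤m = ≮⇒≥ m≮1+n

data LargerNeighbour (x y s : ℤ) : Set where
  larger-left    : ∣ x ℤ.+ y ∣ < ∣ x ∣ → LargerNeighbour x y s
  larger-right   : ∣ x ℤ.+ y ∣ < ∣ y ∣ → LargerNeighbour x y s
  larger-parent  : ∣ x ℤ.+ y ∣ < ∣ x ℤ.+ y ℤ.+ s ∣ → LargerNeighbour x y s
  larger-sibling : ∣ x ℤ.+ y ∣ < ∣ s ∣ → LargerNeighbour x y s

LargerNeighbour-neg : ∀ {x y s} → LargerNeighbour (- x) (- y) (- s) → LargerNeighbour x y s
LargerNeighbour-neg {x} {y} {s} = λ where
    (larger-left lt)    → larger-left (transport (ℤ.∣-i∣≡∣i∣ x) lt)
    (larger-right lt)   → larger-right (transport (ℤ.∣-i∣≡∣i∣ y) lt)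
    (larger-parent lt)  → larger-parent (transport ∣-x-y-s∣≡∣x+y+s∣ lt)
    (larger-sibling lt) → larger-sibling (transport (ℤ.∣-i∣≡∣i∣ s) lt)
  where
  transport : ∀ {m n} → m ≡ n → ∣ - x ℤ.+ - y ∣ < m → ∣ x ℤ.+ y ∣ < n
  transport = subst₂ _<_ (∣-i+-j∣≡∣i+j∣ x y)
  ∣-x-y-s∣≡∣x+y+s∣ : ∣ - x ℤ.+ - y ℤ.+ - s ∣ ≡ ∣ x ℤ.+ y ℤ.+ s ∣
  ∣-x-y-s∣≡∣x+y+s∣ =
    trans (cong (λ v → ∣ v ℤ.+ - s ∣) (sym (ℤ.neg-distrib-+ x y))) (∣-i+-j∣≡∣i+j∣ (x ℤ.+ y) s)

larger-neighbour⁺ : ∀ x y s → 0ℤ ℤ.< x ℤ.+ y →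
  ∣ x ℤ.+ y ∣ ≤ ∣ x ℤ.+ s ∣ → ∣ x ℤ.+ y ∣ ≤ ∣ y ℤ.+ s ∣ → LargerNeighbour x y s
larger-neighbour⁺ -[1+ a ]  y        s        0<x+y _ _ =
  larger-right (∣i+j∣<∣j∣ -[1+ a ] y -<+ 0<x+y)
larger-neighbour⁺ (+ a)     -[1+ b ] s        0<x+y _ _ =
  larger-left (∣i+j∣<∣i∣ (+ a) -[1+ b ] -<+ 0<x+y)
larger-neighbour⁺ (+ a)     (+ b)    +[1+ c ] _ _ _ =
  larger-parent (m<m+n (a + b) z<s)
larger-neighbour⁺ (+ a)     (+ b)    (+ zero) (+<+ 0<a+b) a+b≤a+0 a+b≤b+0 =
  contradiction (+-mono-≤ a≤0 b≤0) (<⇒≱ 0<a+b)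
  where
  b≤0 = +-cancelˡ-≤ a b 0 a+b≤a+0
  a≤0 = +-cancelˡ-≤ b a 0 (subst (_≤ b + 0) (+-comm a b) a+b≤b+0)
larger-neighbour⁺ (+ zero)  (+ b)    -[1+ c ] (+<+ 0<b) _ b≤∣b⊖1+c∣ =
  larger-sibling (o≤∣m⊖1+n∣⇒o<1+n 0<b ≤-refl b≤∣b⊖1+c∣)
larger-neighbour⁺ (+ suc a) (+ b)    -[1+ c ] _ a+b≤∣a⊖1+c∣ _ =
  larger-sibling (o≤∣m⊖1+n∣⇒o<1+n z<s (m≤m+n (suc a) b) a+b≤∣a⊖1+c∣)

larger-neighbour : ∀ x y s → 0 < ∣ x ℤ.+ y ∣ →
  ∣ x ℤ.+ y ∣ ≤ ∣ x ℤ.+ s ∣ → ∣ x ℤ.+ y ∣ ≤ ∣ y ℤ.+ s ∣ → LargerNeighbour x y s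
larger-neighbour x y s 0<∣x+y∣ x+y≤x+s x+y≤y+s with ℤ.<-cmp (x ℤ.+ y) 0ℤ
... | tri< x+y<0 _ _ = LargerNeighbour-neg (larger-neighbour⁺ (- x) (- y) (- s)
        (subst (0ℤ ℤ.<_) (ℤ.neg-distrib-+ x y) (ℤ.neg-mono-< x+y<0))
        (subst₂ _≤_ (sym (∣-i+-j∣≡∣i+j∣ x y)) (sym (∣-i+-j∣≡∣i+j∣ x s)) x+y≤x+s)
        (subst₂ _≤_ (sym (∣-i+-j∣≡∣i+j∣ x y)) (sym (∣-i+-j∣≡∣i+j∣ y s)) x+y≤y+s))
... | tri≈ _ x+y≡0 _ = contradiction (cong ∣_∣ (sym x+y≡0)) (<⇒≢ 0<∣x+y∣)
... | tri> _ _ 0<x+y = larger-neighbour⁺ x y s 0<x+y x+y≤x+s x+y≤y+s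

⊑-trans : ∀ {a b c} → a ⊑ b → b ⊑ c → a ⊑ c
⊑-trans a⊑b here      = a⊑b
⊑-trans a⊑b (left p)  = left (⊑-trans a⊑b p)
⊑-trans a⊑b (right p) = right (⊑-trans a⊑b p)

⊑-root-or-child : ∀ {z T} → z ⊑ T → z ≡ T ⊎ ∃[ s ] (node z s ⊑ T ⊎ node s z ⊑ T)
⊑-root-or-child here = inj₁ refl
⊑-root-or-child (left {r = r} p) with ⊑-root-or-child p
... | inj₁ refl         = inj₂ (r , inj₁ here)
... | inj₂ (s , inj₁ q) = inj₂ (s , inj₁ (left q))
... | inj₂ (s , inj₂ q) = inj₂ (s , inj₂ (left q))
⊑-root-or-child (right {l = l} p) with ⊑-root-or-child p
... | inj₁ refl         = inj₂ (l , inj₂ here)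
... | inj₂ (s , inj₁ q) = inj₂ (s , inj₁ (right q))
... | inj₂ (s , inj₂ q) = inj₂ (s , inj₂ (right q))

leaf-∈-leaves : ∀ {x t} → leaf x ⊑ t → x ∈ leaves t
leaf-∈-leaves here              = here refl
leaf-∈-leaves (left p)          = ∈-++⁺ˡ (leaf-∈-leaves p)
leaf-∈-leaves (right {l = l} p) = ∈-++⁺ʳ (leaves l) (leaf-∈-leaves p)

absSum : Tree → ℕ
absSum (leaf x)   = ∣ x ∣
absSum (node l r) = absSum l + absSum r

∣val∣≤absSum : ∀ t → ∣ val t ∣ ≤ absSum t
∣val∣≤absSum (leaf x)   = ≤-refl
∣val∣≤absSum (node l r) =
  ≤-trans (ℤ.∣i+j∣≤∣i∣+∣j∣ (val l) (val r)) (+-mono-≤ (∣val∣≤absSum l) (∣val∣≤absSum r))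

absSum-mono-⊑ : ∀ {s t} → s ⊑ t → absSum s ≤ absSum t
absSum-mono-⊑ here                = ≤-refl
absSum-mono-⊑ (left {l = l} {r} p)  = ≤-trans (absSum-mono-⊑ p) (m≤m+n (absSum l) (absSum r))
absSum-mono-⊑ (right {l = l} {r} p) = ≤-trans (absSum-mono-⊑ p) (m≤n+m (absSum r) (absSum l))

record Optimal (t : Tree) : Set where
  constructor optimal
  field
    cheapest : ∀ u → leaves u ↭ leaves t → val u ≡ val t → cost t ≤ cost u
open Optimal

minimal⇒optimal : ∀ {X t} → AdditionTreeOver X t →
  (∀ u → AdditionTreeOver X u → cost t ≤ cost u) → Optimal t
minimal⇒optimal t∼X minimal = optimal λ u u↭t _ → minimal u (↭-trans u↭t t∼X)

optimal-left : ∀ {l r} → Optimal (node l r) → Optimal l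
optimal-left {l} {r} opt = optimal λ u u↭l u≡l →
  +-cancelˡ-≤ ∣ val l ℤ.+ val r ∣ _ _ (+-cancelʳ-≤ (cost r) _ _
    (subst (λ v → cost (node l r) ≤ ∣ v ℤ.+ val r ∣ + cost u + cost r) u≡l
      (cheapest opt (node u r) (++⁺ʳ (leaves r) u↭l) (cong (ℤ._+ val r) u≡l))))

optimal-right : ∀ {l r} → Optimal (node l r) → Optimal r
optimal-right {l} {r} opt = optimal λ u u↭r u≡r →
  +-cancelˡ-≤ (∣ val l ℤ.+ val r ∣ + cost l) _ _
    (subst (λ v → cost (node l r) ≤ ∣ val l ℤ.+ v ∣ + cost l + cost u) u≡r
      (cheapest opt (node l u) (++⁺ˡ (leaves l) u↭r) (cong (λ v → val l ℤ.+ v) u≡r)))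

optimal-⊑ : ∀ {s t} → Optimal t → s ⊑ t → Optimal s
optimal-⊑ opt here      = opt
optimal-⊑ opt (left p)  = optimal-⊑ (optimal-left opt) p
optimal-⊑ opt (right p) = optimal-⊑ (optimal-right opt) p

cost-node-comm : ∀ a b → cost (node a b) ≡ cost (node b a)
cost-node-comm a b = trans (cong (λ v → ∣ v ∣ + cost a + cost b) (ℤ.+-comm (val a) (val b)))
                           (ℕ-+.xy∙z≈xz∙y ∣ val b ℤ.+ val a ∣ (cost a) (cost b))

optimal-swap : ∀ {a b} → Optimal (node b a) → Optimal (node a b)
optimal-swap {a} {b} opt = optimal λ u u↭ab u≡ab →
  subst (_≤ cost u) (cost-node-comm b a)
    (cheapest opt u (↭-trans u↭ab (++-comm (leaves a) (leaves b)))
                    (trans u≡ab (ℤ.+-comm (val a) (val b))))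

cost-node-node : ∀ a b c → cost (node (node a b) c) ≡
  ∣ val a ℤ.+ val b ∣ + (∣ val a ℤ.+ val b ℤ.+ val c ∣ + (cost a + cost b + cost c))
cost-node-node a b c =
  rearrange ∣ val a ℤ.+ val b ℤ.+ val c ∣ ∣ val a ℤ.+ val b ∣ (cost a) (cost b) (cost c)
  where
  rearrange : ∀ p q r s t → p + (q + r + s) + t ≡ q + (p + (r + s + t))
  rearrange = solve-∀

optimal-regroup : ∀ {x y s} → Optimal (node (node x y) s) → ∀ a b c →
  leaves (node (node a b) c) ↭ leaves (node (node x y) s) →
  val a ℤ.+ val b ℤ.+ val c ≡ val x ℤ.+ val y ℤ.+ val s →
  cost a + cost b + cost c ≡ cost x + cost y + cost s →
  ∣ val x ℤ.+ val y ∣ ≤ ∣ val a ℤ.+ val b ∣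
optimal-regroup {x} {y} {s} opt a b c abc↭xys abc≡xys costs≡ =
  +-cancelʳ-≤ (∣ val x ℤ.+ val y ℤ.+ val s ∣ + (cost x + cost y + cost s)) _ _
    (subst₂ _≤_ (cost-node-node x y s)
                (trans (cost-node-node a b c)
                       (cong₂ (λ v k → ∣ val a ℤ.+ val b ∣ + (∣ v ∣ + k)) abc≡xys costs≡))
                (cheapest opt (node (node a b) c) abc↭xys abc≡xys))

exchange : ∀ {x y s} → Optimal (node (node x y) s) →
  ∣ val x ℤ.+ val y ∣ ≤ ∣ val x ℤ.+ val s ∣ × ∣ val x ℤ.+ val y ∣ ≤ ∣ val y ℤ.+ val s ∣
exchange {x} {y} {s} opt =
  optimal-regroup opt x s y xsy↭xys (ℤ-+.xy∙z≈xz∙y (val x) (val s) (val y))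
                                    (ℕ-+.xy∙z≈xz∙y (cost x) (cost s) (cost y)) ,
  optimal-regroup opt y s x ysx↭xys (ℤ-+.xy∙z≈zx∙y (val y) (val s) (val x))
                                    (ℕ-+.xy∙z≈zx∙y (cost y) (cost s) (cost x))
  where
  open PermutationReasoning
  xsy↭xys : (leaves x ++ leaves s) ++ leaves y ↭ (leaves x ++ leaves y) ++ leaves s
  xsy↭xys = begin
    (leaves x ++ leaves s) ++ leaves y  ↭⟨ ++-assoc (leaves x) (leaves s) (leaves y) ⟩
    leaves x ++ (leaves s ++ leaves y)  ↭⟨ ++⁺ˡ (leaves x) (++-comm (leaves s) (leaves y)) ⟩
    leaves x ++ (leaves y ++ leaves s)  ↭⟨ ++-assoc (leaves x) (leaves y) (leaves s) ⟨
    (leaves x ++ leaves y) ++ leaves s  ∎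
  ysx↭xys : (leaves y ++ leaves s) ++ leaves x ↭ (leaves x ++ leaves y) ++ leaves s
  ysx↭xys = begin
    (leaves y ++ leaves s) ++ leaves x  ↭⟨ ++-comm (leaves y ++ leaves s) (leaves x) ⟩
    leaves x ++ (leaves y ++ leaves s)  ↭⟨ ++-assoc (leaves x) (leaves y) (leaves s) ⟨
    (leaves x ++ leaves y) ++ leaves s  ∎

module _ {T : Tree} (opt : Optimal T) where

  larger-node-around : ∀ {x y s p} → node x y ⊑ T → s ⊑ T → p ⊑ T →
    Optimal (node (node x y) s) → ∣ val p ∣ ≡ ∣ val x ℤ.+ val y ℤ.+ val s ∣ →
    0 < ∣ val x ℤ.+ val y ∣ → ∃[ w ] w ⊑ T × ∣ val x ℤ.+ val y ∣ < ∣ val w ∣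
  larger-node-around {x} {y} {s} {p} z⊑T s⊑T p⊑T opt′ ∣p∣≡ 0<∣z∣
    with uncurry (larger-neighbour (val x) (val y) (val s) 0<∣z∣) (exchange opt′)
  ... | larger-left lt    = x , ⊑-trans (left here) z⊑T , lt
  ... | larger-right lt   = y , ⊑-trans (right here) z⊑T , lt
  ... | larger-parent lt  = p , p⊑T , subst (_ <_) (sym ∣p∣≡) lt
  ... | larger-sibling lt = s , s⊑T , lt

  leaf-root-or-larger : ∀ z → z ⊑ T → 0 < ∣ val z ∣ →
    (∃[ x ] z ≡ leaf x) ⊎ z ≡ T ⊎ ∃[ w ] w ⊑ T × ∣ val z ∣ < ∣ val w ∣
  leaf-root-or-larger (leaf x) _ _ = inj₁ (x , refl)
  leaf-root-or-larger (node x y) z⊑T 0<∣z∣ with ⊑-root-or-child z⊑T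
  ... | inj₁ z≡T             = inj₂ (inj₁ z≡T)
  ... | inj₂ (s , inj₁ zs⊑T) = inj₂ (inj₂ (larger-node-around z⊑T (⊑-trans (right here) zs⊑T) zs⊑T
          (optimal-⊑ opt zs⊑T) refl 0<∣z∣))
  ... | inj₂ (s , inj₂ sz⊑T) = inj₂ (inj₂ (larger-node-around z⊑T (⊑-trans (left here) sz⊑T) sz⊑T
          (optimal-swap (optimal-⊑ opt sz⊑T))
          (cong ∣_∣ (ℤ.+-comm (val s) (val x ℤ.+ val y))) 0<∣z∣))

  optimal-bounded : ∀ {B} → (∀ {x} → leaf x ⊑ T → ∣ x ∣ ≤ B) → ∣ val T ∣ ≤ B →
    ∀ {z} → z ⊑ T → ∣ val z ∣ ≤ B
  optimal-bounded {B} leaf≤B root≤B {z} z⊑T = ≮⇒≥ λ B<∣z∣ →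
    bounded-ascent-impossible (∣_∣ ∘ val) bounded ascend (z⊑T , B<∣z∣)
    where
    Exceeds : Tree → Set
    Exceeds z = z ⊑ T × B < ∣ val z ∣
    bounded : ∀ {z} → Exceeds z → ∣ val z ∣ ≤ absSum T
    bounded {z} (z⊑T , _) = ≤-trans (∣val∣≤absSum z) (absSum-mono-⊑ z⊑T)
    ascend : ∀ {z} → Exceeds z → ∃[ w ] Exceeds w × ∣ val z ∣ < ∣ val w ∣
    ascend {z} (z⊑T , B<∣z∣) with leaf-root-or-larger z z⊑T (≤-<-trans z≤n B<∣z∣)
    ... | inj₁ (x , refl)            = contradiction (leaf≤B z⊑T) (<⇒≱ B<∣z∣)
    ... | inj₂ (inj₁ refl)           = contradiction root≤B (<⇒≱ B<∣z∣)
    ... | inj₂ (inj₂ (w , w⊑T , lt)) = w , (w⊑T , <-trans B<∣z∣ lt) , lt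

InRange : ℕ → ℤ → Set
InRange H v = ∣ v ∣ ≤ H × v ℤ.< + H

InRange⇒0<H : ∀ {H v} → InRange H v → 0 < H
InRange⇒0<H {v = + n}      (_ , +<+ n<H) = ≤-<-trans z≤n n<H
InRange⇒0<H {v = -[1+ n ]} (1+n≤H , _)   = ≤-trans (s≤s z≤n) 1+n≤H

InRange-pos : ∀ {n H} → n < H → InRange H (+ n)
InRange-pos n<H = <⇒≤ n<H , +<+ n<H

InRange-neg : ∀ {H} → 0 < H → InRange H (- + H)
InRange-neg {suc n} _ = ≤-refl , -<+

∣i∣≤n⇒i≤n : ∀ {i n} → ∣ i ∣ ≤ n → i ℤ.≤ + n
∣i∣≤n⇒i≤n {+ m}       m≤n = +≤+ m≤n
∣i∣≤n⇒i≤n { -[1+ m ]} _   = -≤+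

optimal-InRange : ∀ {T H} → Optimal T →
  (∀ {x} → leaf x ⊑ T → InRange H x) → InRange H (val T) →
  ∀ {z} → z ⊑ T → InRange H (val z)
optimal-InRange {T} {H} opt leaf∈ root∈ {z} z⊑T =
  bound z⊑T , ℤ.≤∧≢⇒< (∣i∣≤n⇒i≤n (bound z⊑T)) z≢H
  where
  bound : ∀ {w} → w ⊑ T → ∣ val w ∣ ≤ H
  bound = optimal-bounded opt (proj₁ ∘ leaf∈) (proj₁ root∈)
  z≢H : val z ≢ + H
  z≢H z≡H with leaf-root-or-larger opt z z⊑T (subst (λ v → 0 < ∣ v ∣) (sym z≡H) (InRange⇒0<H root∈))
  ... | inj₁ (x , refl)            = ℤ.<-irrefl z≡H (proj₂ (leaf∈ z⊑T))
  ... | inj₂ (inj₁ refl)           = ℤ.<-irrefl z≡H (proj₂ root∈)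
  ... | inj₂ (inj₂ (w , w⊑T , lt)) = <⇒≱ (subst (λ v → ∣ v ∣ < ∣ val w ∣) z≡H lt) (bound w⊑T)

Σℤ : List ℤ → ℤ
Σℤ = foldr ℤ._+_ 0ℤ

Σℤ-++ : ∀ xs ys → Σℤ (xs ++ ys) ≡ Σℤ xs ℤ.+ Σℤ ys
Σℤ-++ []       ys = sym (ℤ.+-identityˡ (Σℤ ys))
Σℤ-++ (x ∷ xs) ys =
  trans (cong (λ v → x ℤ.+ v) (Σℤ-++ xs ys)) (sym (ℤ.+-assoc x (Σℤ xs) (Σℤ ys)))

Σℤ-↭ : ∀ {xs ys} → xs ↭ ys → Σℤ xs ≡ Σℤ ys
Σℤ-↭ xs↭ys = foldr-commMonoid (CommutativeMonoid.setoid ℤ.+-0-commutativeMonoid)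
                              ℤ.+-0-isCommutativeMonoid (↭⇒↭ₛ xs↭ys)

val≡Σℤ-leaves : ∀ t → val t ≡ Σℤ (leaves t)
val≡Σℤ-leaves (leaf x)   = sym (ℤ.+-identityʳ x)
val≡Σℤ-leaves (node l r) =
  trans (cong₂ ℤ._+_ (val≡Σℤ-leaves l) (val≡Σℤ-leaves r)) (sym (Σℤ-++ (leaves l) (leaves r)))

Σℤ-map-shift : ∀ {n} (v : Vec ℕ n) W →
  Σℤ (map (λ x → + (x + W)) (toList v)) ≡ + (Vec.sum v + n * W)
Σℤ-map-shift Vec.[]              W = refl
Σℤ-map-shift {suc n} (x Vec.∷ v) W =
  trans (cong (λ k → + (x + W) ℤ.+ k) (Σℤ-map-shift v W))
        (cong +_ (ℕ-+.interchange x W (Vec.sum v) (n * W)))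

Σℤ-replicate : ∀ m n → Σℤ (replicate m (+ n)) ≡ + (m * n)
Σℤ-replicate zero    n = refl
Σℤ-replicate (suc m) n = cong (λ k → + n ℤ.+ k) (Σℤ-replicate m n)

Σℤ-replicate-neg : ∀ m n → Σℤ (replicate m (- + n)) ≡ - + (m * n)
Σℤ-replicate-neg zero    n = refl
Σℤ-replicate-neg (suc m) n =
  trans (cong (λ k → - + n ℤ.+ k) (Σℤ-replicate-neg m n)) (sym (ℤ.neg-distrib-+ (+ n) (+ (m * n))))

ΣXof≡0 : ∀ m K (b : Vec ℕ (3 * m)) → Vec.sum b ≡ m * K → Σℤ (Xof m K b) ≡ 0ℤ
ΣXof≡0 m K b Σb≡mK = begin
  Σℤ (A ++ B ++ C)
    ≡⟨ Σℤ-++ A (B ++ C) ⟩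
  Σℤ A ℤ.+ Σℤ (B ++ C)
    ≡⟨ cong (λ k → Σℤ A ℤ.+ k) (Σℤ-++ B C) ⟩
  Σℤ A ℤ.+ (Σℤ B ℤ.+ Σℤ C)
    ≡⟨ cong₂ ℤ._+_ (Σℤ-map-shift b W) (cong₂ ℤ._+_ (Σℤ-replicate-neg m H) (Σℤ-replicate m h)) ⟩
  + a ℤ.+ (- + (m * H) ℤ.+ + (m * h))
    ≡⟨ ℤ-+.x∙yz≈xz∙y (+ a) (- + (m * H)) (+ (m * h)) ⟩
  + (a + m * h) ℤ.+ - + (m * H)
    ≡⟨ cong (λ k → + k ℤ.+ - + (m * H)) balance ⟩
  + (m * H) ℤ.+ - + (m * H)
    ≡⟨ ℤ.+-inverseʳ (+ (m * H)) ⟩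
  0ℤ ∎
  where
  open ≡-Reasoning
  W = Wof m K
  h = hof m K
  H = Hof m K
  A = map (λ x → + (x + W)) (toList b)
  B = replicate m (- + H)
  C = replicate m (+ h)
  a = Vec.sum b + 3 * m * W
  distrib : ∀ m K W h → m * K + 3 * m * W + m * h ≡ m * (3 * W + K + h)
  distrib = solve-∀
  balance : a + m * h ≡ m * H
  balance = trans (cong (λ k → k + 3 * m * W + m * h) Σb≡mK) (distrib m K W h)

hof<Hof : ∀ m {K} → 0 < K → hof m K < Hof m K
hof<Hof m {K} 0<K = m<n+m (hof m K) (<-≤-trans 0<K (m≤n+m K (3 * Wof m K)))

0<Hof : ∀ m {K} → 0 < K → 0 < Hof m K
0<Hof m 0<K = ≤-<-trans z≤n (hof<Hof m 0<K)

Xof-InRange : ∀ m K (b : Vec ℕ (3 * m)) → 0 < K → (∀ i → 2 * lookup b i < K) →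
  All (InRange (Hof m K)) (Xof m K b)
Xof-InRange m K b 0<K 2b<K =
  ++⁺ (map⁺ {f = λ bi → + (bi + W)} (toList⁺ (lookup⁻ {xs = b} (InRange-pos ∘ a<H))))
      (++⁺ (replicate⁺ m (InRange-neg (0<Hof m 0<K))) (replicate⁺ m (InRange-pos (hof<Hof m 0<K))))
  where
  W = Wof m K
  h = hof m K
  regroup : ∀ K W h → K + W + (W + W + h) ≡ 3 * W + K + h
  regroup = solve-∀
  a<H : ∀ i → lookup b i + W < Hof m K
  a<H i = <-≤-trans (+-monoˡ-< W (≤-<-trans (m≤m+n _ _) (2b<K i)))
                    (subst (K + W ≤_) (regroup K W h) (m≤m+n (K + W) (W + W + h)))

lemma2p6 : (m K : ℕ) (b : Vec ℕ (3 * m)) →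
    0 ℕ.< m → 0 ℕ.< K →
    (∀ i → 0 ℕ.< lookup b i) →
    (∀ i → K ℕ.< 4 * lookup b i) →
    (∀ i → 2 * lookup b i ℕ.< K) →
    Vec.sum b ≡ m * K →
    (Tmin : Tree) → AdditionTreeOver (Xof m K b) Tmin →
    (∀ T → AdditionTreeOver (Xof m K b) T → cost Tmin ℕ.≤ cost T) →
    (z : Tree) → z ⊑ Tmin →
      (val z ℤ.< + 0 → ∣ val z ∣ ℕ.≤ Hof m K) ×
      (+ 0 ℤ.< val z → val z ℤ.< + Hof m K)
lemma2p6 m K b _ 0<K _ _ 2b<K Σb≡mK Tmin Tmin∼X minimal z z⊑Tmin =
  (λ _ → proj₁ z∈) , (λ _ → proj₂ z∈)
  where
  H = Hof m K
  leaf∈ : ∀ {x} → leaf x ⊑ Tmin → InRange H x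
  leaf∈ x⊑Tmin = All.lookup (Xof-InRange m K b 0<K 2b<K) (∈-resp-↭ Tmin∼X (leaf-∈-leaves x⊑Tmin))
  root≡0 : val Tmin ≡ 0ℤ
  root≡0 = trans (val≡Σℤ-leaves Tmin) (trans (Σℤ-↭ Tmin∼X) (ΣXof≡0 m K b Σb≡mK))
  root∈ : InRange H (val Tmin)
  root∈ = subst (InRange H) (sym root≡0) (InRange-pos (0<Hof m 0<K))
  z∈ : InRange H (val z)
  z∈ = optimal-InRange (minimal⇒optimal Tmin∼X minimal) leaf∈ root∈ z⊑Tmin
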